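{- Let $p$ and $q$ be prime numbers with $q=p+2$, and let $C'$ be the curve $y^2=-x^4+(p+q)x^2-pq$. Then: (1) $C'(\mathbf{Q}_p)\neq\emptyset$ and $C'(\mathbf{Q}_q)\neq\emptyset$. (2) $C'(\mathbf{Q}_2)\neq\emptyset$ if and only if $p\equiv1,3,7\pmod 8$.
   Context: $C'(\mathbf{Q}_v)$ denotes the set of points $(x,y)\in\mathbf{Q}_v^2$ satisfying the equation, where $\mathbf{Q}_v$ is the completion of $\mathbf{Q}$ at $v$. -}

module Defs where

open import Data.Nat as ℕ using (ℕ; suc)
open import Data.Integer as ℤ using (ℤ; +_; _-_; _*_; _+_; -_)
open import Data.Integer.Divisibility using (_∣_)
open import Data.Product using (Σ; ∃; _×_)

Cong : ℤ → ℤ → ℕ → Set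
Cong a b m = (+ m) ∣ (a - b)

-- ℓ-adic integers ℤ_ℓ = lim ℤ/ℓ^k, as coherent sequences of integer
-- representatives: seq k is a representative of the class in ℤ/ℓ^k.
record Zadic (ℓ : ℕ) : Set where
  field
    seq : ℕ → ℤ
    coh : ∀ k → Cong (seq (suc k)) (seq k) (ℓ ℕ.^ k)
open Zadic public

-- ℓ-adic numbers ℚ_ℓ = ℤ_ℓ[1/ℓ]: a pair (n , X) represents X / ℓ^n.
record Qadic (ℓ : ℕ) : Set where
  constructor _/ℓ^_
  field
    num : Zadic ℓ
    exp : ℕ
open Qadic public

-- (x , y) ∈ ℚ_ℓ² lies on  C' : y² = -x⁴ + (p+q) x² - p q.
-- With x = X/ℓ^a, y = Y/ℓ^b the equation in ℚ_ℓ is, after clearing the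
-- denominators ℓ^(2b) and ℓ^(4a), the equality in ℤ_ℓ
--   Y² ℓ^(4a) = (-X⁴ + (p+q) X² ℓ^(2a) - p q ℓ^(4a)) ℓ^(2b),
-- and equality in ℤ_ℓ = lim ℤ/ℓ^k means equality modulo every ℓ^k.
OnC' : (p q ℓ : ℕ) → Qadic ℓ → Qadic ℓ → Set
OnC' p q ℓ x y = ∀ k →
  Cong (Y k * Y k * L (4 ℕ.* a))
       ((- (X k * X k * X k * X k)
          + (+ (p ℕ.+ q)) * X k * X k * L (2 ℕ.* a)
          - (+ (p ℕ.* q)) * L (4 ℕ.* a)) * L (2 ℕ.* b))
       (ℓ ℕ.^ k)
  where
    a = exp x
    b = exp y
    X = seq (num x)
    Y = seq (num y)
    L : ℕ → ℤ
    L e = + (ℓ ℕ.^ e)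

C'HasPoint : (p q ℓ : ℕ) → Set
C'HasPoint p q ℓ = Σ (Qadic ℓ) λ x → Σ (Qadic ℓ) λ y → OnC' p q ℓ x y

-- Every point below is integral and comes from Hensel lifting an approximate solution.  Over ℚ_p
-- take x² = p + 1 and y = 1.  Over ℚ_q, where p ≡ -2, a pigeonhole argument gives c² + d² ≡ -2
-- (mod q); then either x = c solves x² ≡ p, or x = c makes y² ≡ (c d)².  Over ℚ₂ take x² = p,
-- x² = q, or x = 0 and y² = -pq according as p ≡ 1, 7 or 3 (mod 8).  When p ≡ 5 (mod 8) the value
-- -(x² - p)(x² - q) has odd 2-adic valuation or unit part ≡ 5, 7 (mod 8) for every x ∈ ℚ₂, while
-- a non-zero square has even valuation and unit part ≡ 1 (mod 8).  Even residues are impossible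
-- because p and p + 2 are both prime.
module Submission where

open import Defs
open import Data.Empty using (⊥; ⊥-elim)
open import Data.Integer as ℤ using (ℤ; +_; -_; _+_; _-_; _*_)
import Data.Integer.Properties as ℤₚ
open import Data.Integer.Divisibility.Signed
open import Data.Integer.Tactic.RingSolver using (solve-∀)
open import Data.Nat as ℕ using (ℕ; zero; suc; _%_)
open import Data.Nat.DivMod using (_/_; m%n<n; m≡m%n+[m/n]*n; [m+kn]%n≡m%n; m*n%n≡0)
import Data.Nat.Properties as ℕₚ
import Data.Nat.Divisibility as ℕᵈ
open import Data.Nat.Coprimality using (prime⇒coprime; coprime-Bézout)
open import Data.Nat.GCD using (module Bézout)
open import Data.Nat.Primality using (Prime; euclidsLemma; prime⇒irreducible; prime⇒nonZero)
import Data.Nat.Tactic.RingSolver as ℕ-Solver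
open import Data.Fin using (Fin; toℕ; fromℕ<; splitAt; _↑ˡ_; _↑ʳ_)
open import Data.Fin.Properties
  using (pigeonhole; toℕ-fromℕ<; toℕ-injective; toℕ<n; splitAt⁻¹-↑ˡ; splitAt⁻¹-↑ʳ)
import Data.Fin.Properties as Finₚ
open import Data.Integer.DivMod using (_%ℕ_; _/ℕ_; n%ℕd<d; a≡a%ℕn+[a/ℕn]*n)
open import Data.Product using (Σ; _×_; _,_; proj₁; proj₂)
open import Data.Sum using (_⊎_; inj₁; inj₂; [_,_]′; map₁)
open import Function.Base using (_∘_)
open import Function.Bundles using (_⇔_; mk⇔)
open import Function.Definitions using (Injective)
open import Relation.Nullary using (¬_)
open import Relation.Nullary.Decidable using (toWitnessFalse)
open import Relation.Binary.Definitions using (tri<; tri≈; tri>)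
open import Relation.Binary.PropositionalEquality

pow : ℕ → ℕ → ℤ
pow ℓ k = + (ℓ ℕ.^ k)

pow-one : ∀ ℓ → pow ℓ 1 ≡ + ℓ
pow-one ℓ = cong +_ (ℕₚ.*-identityʳ ℓ)

pow-suc : ∀ ℓ k → pow ℓ (suc k) ≡ pow ℓ k * + ℓ
pow-suc ℓ k = trans (ℤₚ.pos-* ℓ (ℓ ℕ.^ k)) (ℤₚ.*-comm (+ ℓ) (pow ℓ k))

pow-+ : ∀ ℓ m n → pow ℓ (m ℕ.+ n) ≡ pow ℓ m * pow ℓ n
pow-+ ℓ m n = trans (cong +_ (ℕₚ.^-distribˡ-+-* ℓ m n)) (ℤₚ.pos-* (ℓ ℕ.^ m) (ℓ ℕ.^ n))

pow-mono-∣ : ∀ ℓ {m n} → m ℕ.≤ n → pow ℓ m ∣ pow ℓ n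
pow-mono-∣ ℓ {m} m≤n with ℕₚ.m≤n⇒∃[o]m+o≡n m≤n
... | o , refl = divides (pow ℓ o) (trans (pow-+ ℓ m o) (ℤₚ.*-comm (pow ℓ m) (pow ℓ o)))

∣pow-suc : ∀ ℓ k → + ℓ ∣ pow ℓ (suc k)
∣pow-suc ℓ k = divides (pow ℓ k) (pow-suc ℓ k)

*-pres-∣ : ∀ {a b x y} → a ∣ x → b ∣ y → a * b ∣ x * y
*-pres-∣ {b = b} {x = x} a∣x b∣y = ∣-trans (*-monoˡ-∣ b a∣x) (*-monoʳ-∣ x b∣y)

∣0 : ∀ k → k ∣ + 0
∣0 k = divides (+ 0) (sym (ℤₚ.*-zeroˡ k))

zadic : ∀ {ℓ} (s : ℕ → ℤ) → (∀ k → pow ℓ k ∣ s (suc k) - s k) → Zadic ℓ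
zadic s coherent = record { seq = s ; coh = λ k → ∣⇒∣ᵤ (coherent k) }

const : ∀ {ℓ} → ℤ → Zadic ℓ
const n = zadic (λ _ → n) λ k → subst (_ ∣_) (sym (ℤₚ.+-inverseʳ n)) (∣0 _)

Root : ℕ → (ℤ → ℤ) → Set
Root ℓ f = Σ (Zadic ℓ) λ X → ∀ k → pow ℓ k ∣ f (seq X k)

Root-map : ∀ {ℓ f g} → (∀ z → f z ≡ g z) → Root ℓ f → Root ℓ g
Root-map f≗g (X , root) = X , λ k → subst (_ ∣_) (f≗g (seq X k)) (root k)

quadratic-newton-step : ∀ β γ u z →
  let g = λ w → w * w + β * w + γ in
  g (z - g z * u) ≡ g z * (+ 1 - (+ 2 * z + β) * u) + g z * g z * (u * u)
quadratic-newton-step = solve-∀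

derivative-drift : ∀ β c u z →
  + 1 - (+ 2 * z + β) * u ≡ - ((+ 2 * c + β) * u - + 1) - + 2 * u * (z - c)
derivative-drift = solve-∀

quadratic-hensel : ∀ {ℓ} β γ c u →
  + ℓ ∣ c * c + β * c + γ → + ℓ ∣ (+ 2 * c + β) * u - + 1 →
  Root ℓ (λ z → z * z + β * z + γ)
quadratic-hensel {ℓ} β γ c u ℓ∣g[c] ℓ∣g′[c]u-1 =
  zadic Z coherent , λ k → ∣-trans (pow-mono-∣ ℓ (ℕₚ.n≤1+n k)) (proj₁ (invariant k))
  where
  g : ℤ → ℤ
  g z = z * z + β * z + γ

  Z : ℕ → ℤ
  Z zero    = c
  Z (suc k) = Z k - g (Z k) * u

  invariant : ∀ k → pow ℓ (suc k) ∣ g (Z k) × + ℓ ∣ Z k - c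
  invariant zero =
    subst (_∣ g c) (sym (pow-one ℓ)) ℓ∣g[c] , subst (_ ∣_) (sym (ℤₚ.+-inverseʳ c)) (∣0 _)
  invariant (suc k) = ℓ^[2+k]∣g , ℓ∣drift
    where
    z = Z k
    ℓ^[1+k]∣g = proj₁ (invariant k)
    ℓ∣z-c = proj₂ (invariant k)
    ℓ∣g = ∣-trans (∣pow-suc ℓ k) ℓ^[1+k]∣g

    ℓ∣1-g′[z]u : + ℓ ∣ + 1 - (+ 2 * z + β) * u
    ℓ∣1-g′[z]u = subst (_ ∣_) (sym (derivative-drift β c u z))
      (∣m∣n⇒∣m-n (∣m⇒∣-m ℓ∣g′[c]u-1) (∣n⇒∣m*n (+ 2 * u) ℓ∣z-c))

    ℓ^[2+k]∣g[z]² : pow ℓ (suc (suc k)) ∣ g z * g z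
    ℓ^[2+k]∣g[z]² = ∣-trans (pow-mono-∣ ℓ {m = suc (suc k)} (ℕ.s≤s (ℕₚ.m≤n+m (suc k) k)))
      (subst (_∣ g z * g z) (sym (pow-+ ℓ (suc k) (suc k))) (*-pres-∣ ℓ^[1+k]∣g ℓ^[1+k]∣g))

    ℓ^[2+k]∣g : pow ℓ (suc (suc k)) ∣ g (Z (suc k))
    ℓ^[2+k]∣g = subst (_ ∣_) (sym (quadratic-newton-step β γ u z))
      (∣m∣n⇒∣m+n (subst (_∣ g z * (+ 1 - (+ 2 * z + β) * u)) (sym (pow-suc ℓ (suc k)))
                   (*-pres-∣ ℓ^[1+k]∣g ℓ∣1-g′[z]u))
                 (∣m⇒∣m*n (u * u) ℓ^[2+k]∣g[z]²))

    ℓ∣drift : + ℓ ∣ Z (suc k) - c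
    ℓ∣drift = subst (_ ∣_) (shuffle z (g z * u) c) (∣m∣n⇒∣m-n ℓ∣z-c (∣m⇒∣m*n u ℓ∣g))
      where
      shuffle : ∀ z d c → (z - c) - d ≡ (z - d) - c
      shuffle = solve-∀

  coherent : ∀ k → pow ℓ k ∣ Z (suc k) - Z k
  coherent k = subst (_ ∣_) (step-difference (Z k) (g (Z k) * u))
    (∣m⇒∣-m (∣m⇒∣m*n u (∣-trans (pow-mono-∣ ℓ (ℕₚ.n≤1+n k)) (proj₁ (invariant k)))))
    where
    step-difference : ∀ z d → - d ≡ (z - d) - z
    step-difference = solve-∀

hensel-sqrt : ∀ {ℓ} N c u → + ℓ ∣ c * c - N → + ℓ ∣ + 2 * c * u - + 1 →
  Root ℓ (λ z → z * z - N)
hensel-sqrt N c u ℓ∣c²-N ℓ∣2cu-1 =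
  Root-map (λ z → sym (monic z N))
    (quadratic-hensel (+ 0) (- N) c u (subst (_ ∣_) (monic c N) ℓ∣c²-N)
                                      (subst (_ ∣_) (derivative c u) ℓ∣2cu-1))
  where
  monic : ∀ z N → z * z - N ≡ z * z + + 0 * z + - N
  monic = solve-∀
  derivative : ∀ c u → + 2 * c * u - + 1 ≡ (+ 2 * c + + 0) * u - + 1
  derivative = solve-∀

-- Hensel does not apply to y² = N at ℓ = 2 directly; writing y = 1 + 2z turns it into
-- z² + z - 2M = 0, whose root 0 mod 2 is simple.
hensel-sqrt₂ : ∀ N M → N ≡ + 1 + + 8 * M → Root 2 (λ z → z * z - N)
hensel-sqrt₂ N M refl = zadic Y coherent , root
  where
  Z-root : Root 2 (λ z → z * z + + 1 * z + - (+ 2 * M))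
  Z-root = quadratic-hensel (+ 1) (- (+ 2 * M)) (+ 0) (+ 1) (divides (- M) (g[0] M)) (∣0 _)
    where
    g[0] : ∀ M → + 0 * + 0 + + 1 * + 0 + - (+ 2 * M) ≡ - M * + 2
    g[0] = solve-∀

  Z = seq (proj₁ Z-root)

  Y : ℕ → ℤ
  Y k = + 1 + + 2 * Z k

  coherent : ∀ k → pow 2 k ∣ Y (suc k) - Y k
  coherent k = subst (_ ∣_) (double (Z (suc k)) (Z k))
    (∣n⇒∣m*n (+ 2) (∣ᵤ⇒∣ (coh (proj₁ Z-root) k)))
    where
    double : ∀ a b → + 2 * (a - b) ≡ (+ 1 + + 2 * a) - (+ 1 + + 2 * b)
    double = solve-∀

  root : ∀ k → pow 2 k ∣ Y k * Y k - (+ 1 + + 8 * M)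
  root k = subst (_ ∣_) (complete-square (Z k) M) (∣n⇒∣m*n (+ 4) (proj₂ Z-root k))
    where
    complete-square : ∀ z M → + 4 * (z * z + + 1 * z + - (+ 2 * M))
                              ≡ (+ 1 + + 2 * z) * (+ 1 + + 2 * z) - (+ 1 + + 8 * M)
    complete-square = solve-∀

quartic : ℤ → ℤ → ℤ → ℤ → ℤ
quartic P Q x e = - ((x * x - P * (e * e)) * (x * x - Q * (e * e)))

pow-double : ∀ ℓ a → pow ℓ (2 ℕ.* a) ≡ pow ℓ a * pow ℓ a
pow-double ℓ a = trans (cong (λ n → pow ℓ (a ℕ.+ n)) (ℕₚ.+-identityʳ a)) (pow-+ ℓ a a)

pow-quadruple : ∀ ℓ a → pow ℓ (4 ℕ.* a) ≡ (pow ℓ a * pow ℓ a) * (pow ℓ a * pow ℓ a)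
pow-quadruple ℓ a = begin
  pow ℓ (4 ℕ.* a)                        ≡⟨ cong (pow ℓ) (ℕₚ.*-distribʳ-+ a 2 2) ⟩
  pow ℓ (2 ℕ.* a ℕ.+ 2 ℕ.* a)            ≡⟨ pow-+ ℓ (2 ℕ.* a) (2 ℕ.* a) ⟩
  pow ℓ (2 ℕ.* a) * pow ℓ (2 ℕ.* a)      ≡⟨ cong₂ _*_ (pow-double ℓ a) (pow-double ℓ a) ⟩
  (pow ℓ a * pow ℓ a) * (pow ℓ a * pow ℓ a) ∎
  where open ≡-Reasoning

curve-rhs≡quartic : ∀ p q ℓ a X →
  - (X * X * X * X) + + (p ℕ.+ q) * X * X * pow ℓ (2 ℕ.* a) - + (p ℕ.* q) * pow ℓ (4 ℕ.* a)
  ≡ quartic (+ p) (+ q) X (pow ℓ a)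
curve-rhs≡quartic p q ℓ a X = begin
  - (X * X * X * X) + + (p ℕ.+ q) * X * X * pow ℓ (2 ℕ.* a) - + (p ℕ.* q) * pow ℓ (4 ℕ.* a)
    ≡⟨ cong₂ (λ s t → - (X * X * X * X) + s * X * X * pow ℓ (2 ℕ.* a) - t * pow ℓ (4 ℕ.* a))
             (ℤₚ.pos-+ p q) (ℤₚ.pos-* p q) ⟩
  - (X * X * X * X) + (+ p + + q) * X * X * pow ℓ (2 ℕ.* a) - + p * + q * pow ℓ (4 ℕ.* a)
    ≡⟨ cong₂ (λ e² e⁴ → - (X * X * X * X) + (+ p + + q) * X * X * e² - + p * + q * e⁴)
             (pow-double ℓ a) (pow-quadruple ℓ a) ⟩
  - (X * X * X * X) + (+ p + + q) * X * X * (E * E) - + p * + q * ((E * E) * (E * E))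
    ≡⟨ factor (+ p) (+ q) X E ⟩
  quartic (+ p) (+ q) X E ∎
  where
  open ≡-Reasoning
  E = pow ℓ a
  factor : ∀ P Q x e → - (x * x * x * x) + (P + Q) * x * x * (e * e) - P * Q * ((e * e) * (e * e))
                       ≡ - ((x * x - P * (e * e)) * (x * x - Q * (e * e)))
  factor = solve-∀

quartic-homogeneous : ∀ P Q f x e → quartic P Q (f * x) (f * e) ≡ (f * f) * (f * f) * quartic P Q x e
quartic-homogeneous = expanded
  where
  expanded : ∀ P Q f x e →
    - ((f * x * (f * x) - P * (f * e * (f * e))) * (f * x * (f * x) - Q * (f * e * (f * e))))
    ≡ (f * f) * (f * f) * - ((x * x - P * (e * e)) * (x * x - Q * (e * e)))
  expanded = solve-∀

integral-point : ∀ {p q ℓ} (X Y : Zadic ℓ) →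
  (∀ k → pow ℓ k ∣ seq Y k * seq Y k + (seq X k * seq X k - + p) * (seq X k * seq X k - + q)) →
  C'HasPoint p q ℓ
integral-point {p} {q} {ℓ} X Y on-curve =
  X /ℓ^ 0 , Y /ℓ^ 0 , λ k → ∣⇒∣ᵤ (subst (_ ∣_) (equation (seq X k) (seq Y k)) (on-curve k))
  where
  open ≡-Reasoning
  equation : ∀ x y → y * y + (x * x - + p) * (x * x - + q)
    ≡ y * y * + 1 - (- (x * x * x * x) + + (p ℕ.+ q) * x * x * + 1 - + (p ℕ.* q) * + 1) * + 1
  equation x y = begin
    y * y + (x * x - + p) * (x * x - + q)  ≡⟨ affine (+ p) (+ q) x y ⟩
    y * y * + 1 - quartic (+ p) (+ q) x (+ 1) * + 1
      ≡⟨ cong (λ r → y * y * + 1 - r * + 1) (sym (curve-rhs≡quartic p q ℓ 0 x)) ⟩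
    y * y * + 1 - (- (x * x * x * x) + + (p ℕ.+ q) * x * x * + 1 - + (p ℕ.* q) * + 1) * + 1 ∎
    where
    affine : ∀ P Q x y → y * y + (x * x - P) * (x * x - Q)
                       ≡ y * y * + 1 - - ((x * x - P * (+ 1 * + 1)) * (x * x - Q * (+ 1 * + 1))) * + 1
    affine = solve-∀

point-with-x²≡p : ∀ {p q ℓ} → Root ℓ (λ z → z * z - + p) → C'HasPoint p q ℓ
point-with-x²≡p {p} {q} (X , root) = integral-point X (const (+ 0))
  λ k → subst (_ ∣_) (y≡0 (seq X k) (+ p) (+ q)) (∣m⇒∣m*n (seq X k * seq X k - + q) (root k))
  where
  y≡0 : ∀ x P Q → (x * x - P) * (x * x - Q) ≡ + 0 * + 0 + (x * x - P) * (x * x - Q)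
  y≡0 = solve-∀

point-with-x²≡q : ∀ {p q ℓ} → Root ℓ (λ z → z * z - + q) → C'HasPoint p q ℓ
point-with-x²≡q {p} {q} (X , root) = integral-point X (const (+ 0))
  λ k → subst (_ ∣_) (y≡0 (seq X k) (+ p) (+ q)) (∣n⇒∣m*n (seq X k * seq X k - + p) (root k))
  where
  y≡0 : ∀ x P Q → (x * x - P) * (x * x - Q) ≡ + 0 * + 0 + (x * x - P) * (x * x - Q)
  y≡0 = solve-∀

point-with-x≡ : ∀ {p q ℓ} c → Root ℓ (λ z → z * z + (c * c - + p) * (c * c - + q)) →
  C'HasPoint p q ℓ
point-with-x≡ c (Y , root) = integral-point (const c) Y root

odd-cast : ∀ r → + suc (2 ℕ.* r) ≡ + 1 + + 2 * + r
odd-cast r = trans (ℤₚ.pos-+ 1 (2 ℕ.* r)) (cong (_+_ (+ 1)) (ℤₚ.pos-* 2 r))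

twin-cast : ∀ p → + (p ℕ.+ 2) ≡ + p + + 2
twin-cast p = ℤₚ.pos-+ p 2

-- With x² = p + 1 and y = 1 one has y² + (x² - p)(x² - p - 2) = (x² - p - 1)².
point-over-ℚ_p : ∀ {p} r → p ≡ suc (2 ℕ.* r) → C'HasPoint p (p ℕ.+ 2) p
point-over-ℚ_p {p} r refl = integral-point X (const (+ 1)) on-curve
  where
  sqrt : Root p (λ z → z * z - (+ p + + 1))
  sqrt = hensel-sqrt (+ p + + 1) (+ 1) (+ 1 + + r)
           (divides (- + 1) (p∣1-[p+1] (+ p)))
           (divides (+ 1) (trans (inverse-of-2 (+ r)) (cong (+ 1 *_) (sym (odd-cast r)))))
    where
    p∣1-[p+1] : ∀ P → + 1 * + 1 - (P + + 1) ≡ - + 1 * P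
    p∣1-[p+1] = solve-∀
    inverse-of-2 : ∀ r → + 2 * + 1 * (+ 1 + r) - + 1 ≡ + 1 * (+ 1 + + 2 * r)
    inverse-of-2 = solve-∀

  X = proj₁ sqrt

  on-curve : ∀ k → pow p k ∣ + 1 * + 1 + (seq X k * seq X k - + p) * (seq X k * seq X k - + (p ℕ.+ 2))
  on-curve k = subst (pow p k ∣_) equation (∣m⇒∣m*n (x * x - (+ p + + 1)) (proj₂ sqrt k))
    where
    x = seq X k
    square : ∀ x P → (x * x - (P + + 1)) * (x * x - (P + + 1))
                     ≡ + 1 * + 1 + (x * x - P) * (x * x - (P + + 2))
    square = solve-∀
    equation = trans (square x (+ p))
      (cong (λ Q → + 1 * + 1 + (x * x - + p) * (x * x - Q)) (sym (twin-cast p)))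

pigeonhole-two-injections : ∀ {m n k} → k ℕ.< m ℕ.+ n →
  (f : Fin m → Fin k) (g : Fin n → Fin k) → Injective _≡_ _≡_ f → Injective _≡_ _≡_ g →
  Σ (Fin m) λ i → Σ (Fin n) λ j → f i ≡ g j
pigeonhole-two-injections {m} {n} k<m+n f g f-inj g-inj
  with pigeonhole k<m+n ([ f , g ]′ ∘ splitAt m)
... | i , j , i<j , fgi≡fgj with splitAt m i in split-i | splitAt m j in split-j
... | inj₁ a | inj₁ b = ⊥-elim (Finₚ.<⇒≢ i<j (trans (sym (splitAt⁻¹-↑ˡ split-i))
                          (trans (cong (_↑ˡ n) (f-inj fgi≡fgj)) (splitAt⁻¹-↑ˡ split-j))))
... | inj₁ a | inj₂ b = a , b , fgi≡fgj
... | inj₂ a | inj₁ b = b , a , sym fgi≡fgj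
... | inj₂ a | inj₂ b = ⊥-elim (Finₚ.<⇒≢ i<j (trans (sym (splitAt⁻¹-↑ʳ split-i))
                          (trans (cong (m ↑ʳ_) (g-inj fgi≡fgj)) (splitAt⁻¹-↑ʳ split-j))))

inverse-* : ∀ {k a b u v} → k ∣ a * u - + 1 → k ∣ b * v - + 1 → k ∣ (a * b) * (u * v) - + 1
inverse-* {k} {a} {b} {u} {v} k∣au-1 k∣bv-1 =
  subst (k ∣_) (expand a b u v) (∣m∣n⇒∣m+n (∣m⇒∣m*n (b * v) k∣au-1) k∣bv-1)
  where
  expand : ∀ a b u v → (a * u - + 1) * (b * v) + (b * v - + 1) ≡ (a * b) * (u * v) - + 1
  expand = solve-∀

module _ {q : ℕ} (q-prime : Prime q) where

  private instance
    q≢0 : ℕ.NonZero q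
    q≢0 = prime⇒nonZero q-prime

  inverse-mod-prime : ∀ m → 0 ℕ.< m → m ℕ.< q → Σ ℤ λ u → + q ∣ + m * u - + 1
  inverse-mod-prime m 0<m m<q with coprime-Bézout (prime⇒coprime q-prime {{ℕ.>-nonZero 0<m}} m<q)
  ... | Bézout.+- x y 1+ym≡xq = - + y , divides (- + x) (begin
    + m * - + y - + 1    ≡⟨ rearrange (+ m) (+ y) ⟩
    - (+ 1 + + y * + m)  ≡⟨ cong -_ (cast {y} {m} {x} {q} 1+ym≡xq) ⟩
    - (+ x * + q)        ≡⟨ ℤₚ.neg-distribˡ-* (+ x) (+ q) ⟩
    - + x * + q          ∎)
    where
    open ≡-Reasoning
    rearrange : ∀ m y → m * - y - + 1 ≡ - (+ 1 + y * m)
    rearrange = solve-∀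
    cast : ∀ {b c d e} → 1 ℕ.+ b ℕ.* c ≡ d ℕ.* e → + 1 + + b * + c ≡ + d * + e
    cast {b} {c} {d} {e} eq = trans (cong (_+_ (+ 1)) (sym (ℤₚ.pos-* b c)))
                                    (trans (cong +_ eq) (ℤₚ.pos-* d e))
  ... | Bézout.-+ x y 1+xq≡ym = + y , divides (+ x) (begin
    + m * + y - + 1          ≡⟨ cong (λ z → z - + 1) (ℤₚ.pos-* m y) ⟨
    + (m ℕ.* y) - + 1        ≡⟨ cong (λ z → + z - + 1) (trans (ℕₚ.*-comm m y) (sym 1+xq≡ym)) ⟩
    + (1 ℕ.+ x ℕ.* q) - + 1  ≡⟨ cong (λ z → z - + 1) (ℤₚ.pos-+ 1 (x ℕ.* q)) ⟩
    + 1 + + (x ℕ.* q) - + 1  ≡⟨ cancel (+ (x ℕ.* q)) ⟩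
    + (x ℕ.* q)              ≡⟨ ℤₚ.pos-* x q ⟩
    + x * + q                ∎)
    where
    open ≡-Reasoning
    cancel : ∀ z → + 1 + z - + 1 ≡ z
    cancel = solve-∀

  residue : ℤ → Fin q
  residue a = fromℕ< (n%ℕd<d a q)

  residue-≡⇒∣ : ∀ a b → residue a ≡ residue b → + q ∣ a - b
  residue-≡⇒∣ a b eq = divides (a /ℕ q - b /ℕ q) (begin
    a - b
      ≡⟨ cong₂ _-_ (a≡a%ℕn+[a/ℕn]*n a q) (a≡a%ℕn+[a/ℕn]*n b q) ⟩
    (+ (a %ℕ q) + a /ℕ q * + q) - (+ (b %ℕ q) + b /ℕ q * + q)
      ≡⟨ cong (λ r → (+ r + a /ℕ q * + q) - (+ (b %ℕ q) + b /ℕ q * + q)) %ℕ-eq ⟩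
    (+ (b %ℕ q) + a /ℕ q * + q) - (+ (b %ℕ q) + b /ℕ q * + q)
      ≡⟨ cancel (+ (b %ℕ q)) (a /ℕ q) (b /ℕ q) (+ q) ⟩
    (a /ℕ q - b /ℕ q) * + q ∎)
    where
    open ≡-Reasoning
    %ℕ-eq : a %ℕ q ≡ b %ℕ q
    %ℕ-eq = trans (sym (toℕ-fromℕ< (n%ℕd<d a q)))
                  (trans (cong toℕ eq) (toℕ-fromℕ< (n%ℕd<d b q)))
    cancel : ∀ r s t q → (r + s * q) - (r + t * q) ≡ (s - t) * q
    cancel = solve-∀

  ∣∧<⇒≡0 : ∀ {m} → q ℕᵈ.∣ m → m ℕ.< q → m ≡ 0
  ∣∧<⇒≡0 {zero}  _   _   = refl
  ∣∧<⇒≡0 {suc m} q∣m m<q = ⊥-elim (ℕᵈ.>⇒∤ m<q q∣m)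

  squares-distinct : ∀ {c d} → c ℕ.+ d ℕ.< q → + q ∣ + c * + c - + d * + d → c ≡ d
  squares-distinct {c} {d} c+d<q q∣c²-d²
    with euclidsLemma ℤ.∣ + c - + d ∣ (c ℕ.+ d) q-prime
           (subst (q ℕᵈ.∣_) (ℤₚ.abs-* (+ c - + d) (+ c + + d))
             (∣⇒∣ᵤ (subst (+ q ∣_) (difference-of-squares (+ c) (+ d)) q∣c²-d²)))
    where
    difference-of-squares : ∀ a b → a * a - b * b ≡ (a - b) * (a + b)
    difference-of-squares = solve-∀
  ... | inj₁ q∣∣c-d∣ = ℤₚ.+-injective (ℤₚ.i-j≡0⇒i≡j (+ c) (+ d) (ℤₚ.∣i∣≡0⇒i≡0
    (∣∧<⇒≡0 q∣∣c-d∣ (ℕₚ.≤-<-trans (ℤₚ.∣i-j∣≤∣i∣+∣j∣ (+ c) (+ d)) c+d<q))))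
  ... | inj₂ q∣c+d = trans (ℕₚ.m+n≡0⇒m≡0 c c+d≡0) (sym (ℕₚ.m+n≡0⇒n≡0 c c+d≡0))
    where
    c+d≡0 = ∣∧<⇒≡0 q∣c+d c+d<q

  -- Pigeonhole on the h + 1 residues of c² and the h + 1 residues of -(d² + n), 0 ≤ c, d ≤ h.
  sum-of-two-squares : ∀ h → q ≡ suc (2 ℕ.* h) → ∀ n →
    Σ ℕ λ c → Σ ℕ λ d → c ℕ.≤ h × d ℕ.≤ h × + q ∣ + c * + c + + d * + d + n
  sum-of-two-squares h q≡2h+1 n =
    toℕ c , toℕ d , ≤h c , ≤h d , subst (+ q ∣_) (collision (+ toℕ c) (+ toℕ d) n)
      (residue-≡⇒∣ (+ toℕ c * + toℕ c) (- (+ toℕ d * + toℕ d + n)) c≈d)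
    where
    collision : ∀ c d n → c * c - - (d * d + n) ≡ c * c + d * d + n
    collision = solve-∀

    ≤h : (c : Fin (suc h)) → toℕ c ℕ.≤ h
    ≤h c = ℕₚ.≤-pred (toℕ<n c)

    q<2[h+1] : q ℕ.< suc h ℕ.+ suc h
    q<2[h+1] = ℕₚ.≤-reflexive (trans (cong suc q≡2h+1) (double h))
      where
      double : ∀ h → suc (suc (2 ℕ.* h)) ≡ suc h ℕ.+ suc h
      double = ℕ-Solver.solve-∀

    c+d<q : (c d : Fin (suc h)) → toℕ c ℕ.+ toℕ d ℕ.< q
    c+d<q c d = ℕₚ.<-≤-trans (ℕ.s≤s (ℕₚ.+-mono-≤ (≤h c) (≤h d)))
      (ℕₚ.≤-reflexive (trans (cong (λ n → suc (h ℕ.+ n)) (sym (ℕₚ.+-identityʳ h))) (sym q≡2h+1)))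

    square minus-square-n : Fin (suc h) → Fin q
    square c = residue (+ toℕ c * + toℕ c)
    minus-square-n d = residue (- (+ toℕ d * + toℕ d + n))

    square-injective : Injective _≡_ _≡_ square
    square-injective {c} {d} eq = toℕ-injective (squares-distinct (c+d<q c d)
      (residue-≡⇒∣ (+ toℕ c * + toℕ c) (+ toℕ d * + toℕ d) eq))

    minus-square-n-injective : Injective _≡_ _≡_ minus-square-n
    minus-square-n-injective {c} {d} eq = toℕ-injective (sym (squares-distinct (c+d<q d c)
      (subst (+ q ∣_) (swap (+ toℕ c) (+ toℕ d) n)
        (residue-≡⇒∣ (- (+ toℕ c * + toℕ c + n)) (- (+ toℕ d * + toℕ d + n)) eq))))
      where
      swap : ∀ c d n → - (c * c + n) - - (d * d + n) ≡ d * d - c * c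
      swap = solve-∀

    collide = pigeonhole-two-injections q<2[h+1] square minus-square-n square-injective minus-square-n-injective
    c = proj₁ collide
    d = proj₁ (proj₂ collide)
    c≈d = proj₂ (proj₂ collide)

module _ {p : ℕ} (r : ℕ) (p≡2r+1 : p ≡ suc (2 ℕ.* r)) (q-prime : Prime (p ℕ.+ 2)) where

  private
    q h : ℕ
    q = p ℕ.+ 2
    h = suc r

    q≡2h+1 : q ≡ suc (2 ℕ.* h)
    q≡2h+1 = trans (cong (ℕ._+ 2) p≡2r+1) (shift r)
      where
      shift : ∀ r → suc (2 ℕ.* r) ℕ.+ 2 ≡ suc (2 ℕ.* suc r)
      shift = ℕ-Solver.solve-∀

    <q : ∀ {m} → m ℕ.≤ 2 ℕ.* h → m ℕ.< q
    <q {m} m≤2h = subst (m ℕ.<_) (sym q≡2h+1) (ℕ.s≤s m≤2h)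

    inverse-of-double : ∀ c → 0 ℕ.< c → c ℕ.≤ h → Σ ℤ λ u → + q ∣ + 2 * + c * u - + 1
    inverse-of-double c 0<c c≤h
      with inverse-mod-prime q-prime (2 ℕ.* c) (ℕₚ.*-monoʳ-< 2 0<c) (<q (ℕₚ.*-monoʳ-≤ 2 c≤h))
    ... | u , q∣2cu-1 = u , subst (λ m → + q ∣ m * u - + 1) (ℤₚ.pos-* 2 c) q∣2cu-1

    inverse-of-suc : ∀ d → d ℕ.< h → Σ ℤ λ u → + q ∣ + suc d * u - + 1
    inverse-of-suc d d<h = inverse-mod-prime q-prime (suc d) (ℕ.s≤s ℕ.z≤n)
                             (<q (ℕₚ.≤-trans d<h (ℕₚ.m≤n*m h 2)))

    q∤2 : ¬ (+ q ∣ + 2)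
    q∤2 q∣2 = ℕᵈ.>⇒∤ (<q {2} (ℕₚ.*-monoʳ-≤ 2 (ℕ.s≤s ℕ.z≤n))) (∣⇒∣ᵤ q∣2)

    point-of-sum-of-two-squares : ∀ c d → 0 ℕ.< c → c ℕ.≤ h → d ℕ.≤ h →
      + q ∣ + c * + c + + d * + d + + 2 → C'HasPoint p q q
    point-of-sum-of-two-squares c zero 0<c c≤h _ q∣c²+2 with inverse-of-double c 0<c c≤h
    ... | u , q∣2cu-1 = point-with-x²≡p (hensel-sqrt (+ p) (+ c) u q∣c²-p q∣2cu-1)
      where
      q∣c²-p : + q ∣ + c * + c - + p
      q∣c²-p = subst (+ q ∣_) (shift (+ c) (+ p) (+ q) (twin-cast p))
                 (∣m∣n⇒∣m-n q∣c²+2 ∣-refl)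
        where
        shift : ∀ c P Q → Q ≡ P + + 2 → c * c + + 0 * + 0 + + 2 - Q ≡ c * c - P
        shift c P _ refl = identity c P
          where
          identity : ∀ c P → c * c + + 0 * + 0 + + 2 - (P + + 2) ≡ c * c - P
          identity = solve-∀
    point-of-sum-of-two-squares c (suc d) 0<c c≤h d<h q∣c²+d²+2
      with inverse-of-double c 0<c c≤h | inverse-of-suc d d<h
    ... | u , q∣2cu-1 | v , q∣dv-1 =
      point-with-x≡ (+ c) (Root-map (λ z → cong (_+_ (z * z)) (ℤₚ.neg-involutive _))
        (hensel-sqrt (- ((c′ * c′ - + p) * (c′ * c′ - + q))) (c′ * d′) (u * v)
                     q∣[cd]²-N q∣2cduv-1))
      where
      c′ d′ : ℤ
      c′ = + c
      d′ = + suc d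

      q∣2cduv-1 : + q ∣ + 2 * (c′ * d′) * (u * v) - + 1
      q∣2cduv-1 = subst (λ m → + q ∣ m * (u * v) - + 1) (ℤₚ.*-assoc (+ 2) c′ d′)
        (inverse-* {+ q} {+ 2 * c′} {d′} {u} {v} q∣2cu-1 q∣dv-1)

      expand : ∀ c d P Q → Q ≡ P + + 2 →
        (c * d) * (c * d) - - ((c * c - P) * (c * c - Q))
        ≡ c * c * (c * c + d * d + + 2) - Q * (+ 2 * c * c - P)
      expand c d P _ refl = identity c d P
        where
        identity : ∀ c d P → (c * d) * (c * d) - - ((c * c - P) * (c * c - (P + + 2)))
                             ≡ c * c * (c * c + d * d + + 2) - (P + + 2) * (+ 2 * c * c - P)
        identity = solve-∀

      q∣[cd]²-N : + q ∣ (c′ * d′) * (c′ * d′) - - ((c′ * c′ - + p) * (c′ * c′ - + q))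
      q∣[cd]²-N = subst (+ q ∣_) (sym (expand c′ d′ (+ p) (+ q) (twin-cast p)))
        (∣m∣n⇒∣m-n (∣n⇒∣m*n (c′ * c′) q∣c²+d²+2)
                   (∣m⇒∣m*n (+ 2 * c′ * c′ - + p) ∣-refl))

  point-over-ℚ_q : C'HasPoint p (p ℕ.+ 2) (p ℕ.+ 2)
  point-over-ℚ_q = from-representation (sum-of-two-squares q-prime h q≡2h+1 (+ 2))
    where
    from-representation :
      (Σ ℕ λ c → Σ ℕ λ d → c ℕ.≤ h × d ℕ.≤ h × + q ∣ + c * + c + + d * + d + + 2) → C'HasPoint p q q
    from-representation (zero , zero , _ , _ , q∣2) = ⊥-elim (q∤2 q∣2)
    from-representation (zero , suc d , _ , d<h , q∣d²+2) =
      point-of-sum-of-two-squares (suc d) 0 (ℕ.s≤s ℕ.z≤n) d<h ℕ.z≤n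
        (subst (λ s → + q ∣ s + + 2) (ℤₚ.+-comm (+ 0 * + 0) (+ suc d * + suc d)) q∣d²+2)
    from-representation (suc c , d , c<h , d≤h , q∣c²+d²+2) =
      point-of-sum-of-two-squares (suc c) d (ℕ.s≤s ℕ.z≤n) c<h d≤h q∣c²+d²+2

Odd : ℤ → Set
Odd u = Σ ℤ λ r → u ≡ + 1 + + 2 * r

even-or-odd : ∀ n → Σ ℤ λ m → n ≡ + 2 * m ⊎ n ≡ + 1 + + 2 * m
even-or-odd n with n %ℕ 2 | n%ℕd<d n 2 | a≡a%ℕn+[a/ℕn]*n n 2
... | 0           | _                 | n≡ = n /ℕ 2 , inj₁ (trans n≡ (even (n /ℕ 2)))
  where
  even : ∀ m → + 0 + m * + 2 ≡ + 2 * m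
  even = solve-∀
... | 1           | _                 | n≡ = n /ℕ 2 , inj₂ (trans n≡ (odd (n /ℕ 2)))
  where
  odd : ∀ m → + 1 + m * + 2 ≡ + 1 + + 2 * m
  odd = solve-∀
... | suc (suc _) | ℕ.s≤s (ℕ.s≤s ()) | _

odd⇒2∤ : ∀ {u} → Odd u → ¬ (+ 2 ∣ u)
odd⇒2∤ {u} (r , refl) 2∣u = ℕᵈ.>⇒∤ (ℕ.s≤s (ℕ.s≤s ℕ.z≤n)) (∣⇒∣ᵤ 2∣1)
  where
  2∣1 : + 2 ∣ + 1
  2∣1 = subst (+ 2 ∣_) (cancel r) (∣m∣n⇒∣m-n 2∣u (∣n⇒∣m*n r ∣-refl))
    where
    cancel : ∀ r → + 1 + + 2 * r - r * + 2 ≡ + 1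
    cancel = solve-∀

odd-* : ∀ {a b} → Odd a → Odd b → Odd (a * b)
odd-* (r , refl) (s , refl) = r + s + + 2 * r * s , expand r s
  where
  expand : ∀ r s → (+ 1 + + 2 * r) * (+ 1 + + 2 * s) ≡ + 1 + + 2 * (r + s + + 2 * r * s)
  expand = solve-∀

odd-neg : ∀ {a} → Odd a → Odd (- a)
odd-neg (r , refl) = - + 1 - r , negate r
  where
  negate : ∀ r → - (+ 1 + + 2 * r) ≡ + 1 + + 2 * (- + 1 - r)
  negate = solve-∀

odd-+8* : ∀ {a} W → Odd a → Odd (a + + 8 * W)
odd-+8* W (r , refl) = r + + 4 * W , regroup r W
  where
  regroup : ∀ r W → + 1 + + 2 * r + + 8 * W ≡ + 1 + + 2 * (r + + 4 * W)
  regroup = solve-∀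

odd-square : ∀ {w} → Odd w → Σ ℤ λ M → w * w ≡ + 1 + + 8 * M
odd-square (r , refl) with even-or-odd r
... | m , inj₁ refl = m * (+ 2 * m + + 1) , expand m
  where
  expand : ∀ m → (+ 1 + + 2 * (+ 2 * m)) * (+ 1 + + 2 * (+ 2 * m)) ≡ + 1 + + 8 * (m * (+ 2 * m + + 1))
  expand = solve-∀
... | m , inj₂ refl = (+ 2 * m + + 1) * (m + + 1) , expand m
  where
  expand : ∀ m → (+ 1 + + 2 * (+ 1 + + 2 * m)) * (+ 1 + + 2 * (+ 1 + + 2 * m))
               ≡ + 1 + + 8 * ((+ 2 * m + + 1) * (m + + 1))
  expand = solve-∀

≢1-mod-8 : ∀ c W → ¬ (+ 8 ∣ + c - + 1) → ¬ (+ 8 ∣ + c + + 8 * W - + 1)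
≢1-mod-8 c W 8∤c-1 8∣c+8W-1 =
  8∤c-1 (subst (+ 8 ∣_) (cancel (+ c) W) (∣m∣n⇒∣m-n 8∣c+8W-1 (∣n⇒∣m*n W ∣-refl)))
  where
  cancel : ∀ c W → c + + 8 * W - + 1 - W * + 8 ≡ c - + 1
  cancel = solve-∀

2-power-split : ∀ m n →
  pow 2 m ∣ n ⊎ Σ ℕ λ j → j ℕ.< m × Σ ℤ λ u → Odd u × n ≡ pow 2 j * u
2-power-split zero    n = inj₁ (divides n (sym (ℤₚ.*-identityʳ n)))
2-power-split (suc m) n with even-or-odd n
... | k , inj₂ n≡1+2k = inj₂ (0 , ℕ.s≤s ℕ.z≤n , n , (k , n≡1+2k) , sym (ℤₚ.*-identityˡ n))
... | k , inj₁ refl with 2-power-split m k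
...   | inj₁ (divides w refl) =
  inj₁ (divides w (trans (regroup w (pow 2 m)) (cong (w *_) (sym (pow-suc 2 m)))))
  where
  regroup : ∀ w E → + 2 * (w * E) ≡ w * (E * + 2)
  regroup = solve-∀
...   | inj₂ (j , j<m , u , odd-u , refl) =
  inj₂ (suc j , ℕ.s≤s j<m , u , odd-u , trans (regroup (pow 2 j) u) (cong (_* u) (sym (pow-suc 2 j))))
  where
  regroup : ∀ E u → + 2 * (E * u) ≡ E * + 2 * u
  regroup = solve-∀

pow-cancel : ∀ ℓ .{{_ : ℕ.NonZero ℓ}} s d {W} → pow ℓ (s ℕ.+ d) ∣ pow ℓ s * W → pow ℓ d ∣ W
pow-cancel ℓ s d {W} =
  *-cancelˡ-∣ (pow ℓ s) {{ℕₚ.m^n≢0 ℓ s}} ∘ subst (_∣ pow ℓ s * W) (pow-+ ℓ s d)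

odd-part-exact : ∀ s {U} → Odd U → ¬ (pow 2 (suc s) ∣ pow 2 s * U)
odd-part-exact s {U} odd-U 2^[1+s]∣2^sU =
  odd⇒2∤ odd-U
    (pow-cancel 2 s 1 (subst (λ n → pow 2 n ∣ pow 2 s * U) (ℕₚ.+-comm 1 s) 2^[1+s]∣2^sU))

smaller-exponent-absurd : ∀ {K s t U V} → s ℕ.< t → Odd U → 3 ℕ.+ s ℕ.≤ K →
  pow 2 K ∣ pow 2 s * U - pow 2 t * V → ⊥
smaller-exponent-absurd {K} {s} {t} {U} {V} s<t odd-U 3+s≤K 2^K∣ = odd-part-exact s odd-U
  (subst (pow 2 (suc s) ∣_) (cancel (pow 2 s * U) (pow 2 t * V))
    (∣m∣n⇒∣m+n (∣-trans (pow-mono-∣ 2 (ℕₚ.≤-trans (ℕₚ.m≤n+m (suc s) 2) 3+s≤K)) 2^K∣)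
               (∣m⇒∣m*n V (pow-mono-∣ 2 s<t))))
  where
  cancel : ∀ A B → A - B + B ≡ A
  cancel = solve-∀

odd-parts-agree : ∀ {K s t U V} → Odd U → Odd V → 3 ℕ.+ s ℕ.≤ K → 3 ℕ.+ t ℕ.≤ K →
  pow 2 K ∣ pow 2 s * U - pow 2 t * V → s ≡ t × + 8 ∣ U - V
odd-parts-agree {K} {s} {t} {U} {V} odd-U odd-V 3+s≤K 3+t≤K 2^K∣ with ℕₚ.<-cmp s t
... | tri< s<t _ _ = ⊥-elim (smaller-exponent-absurd s<t odd-U 3+s≤K 2^K∣)
... | tri> _ _ t<s = ⊥-elim (smaller-exponent-absurd t<s odd-V 3+t≤K
                        (subst (pow 2 K ∣_) (negate (pow 2 s * U) (pow 2 t * V)) (∣m⇒∣-m 2^K∣)))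
  where
  negate : ∀ A B → - (A - B) ≡ B - A
  negate = solve-∀
... | tri≈ _ refl _ = refl , pow-cancel 2 s 3
  (∣-trans (pow-mono-∣ 2 (subst (ℕ._≤ K) (ℕₚ.+-comm 3 s) 3+s≤K))
           (subst (pow 2 K ∣_) (factor (pow 2 s) U V) 2^K∣))
  where
  factor : ∀ E U V → E * U - E * V ≡ E * (U - V)
  factor = solve-∀

-- A non-zero square in ℚ₂ is 2^(even) times a unit ≡ 1 (mod 8); the obstruction excludes this shape.
record NonSquare₂ (n : ℤ) : Set where
  field
    exponent    : ℕ
    unit        : ℤ
    unit-odd    : Odd unit
    factorised  : n ≡ pow 2 exponent * unit
    obstruction : exponent % 2 ≡ 1 ⊎ ¬ (+ 8 ∣ unit - + 1)

NonSquare₂-*-pow-even : ∀ {n} → NonSquare₂ n → ∀ b → NonSquare₂ (n * pow 2 (2 ℕ.* b))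
NonSquare₂-*-pow-even {n} N b = record
  { exponent    = exponent ℕ.+ 2 ℕ.* b
  ; unit        = unit
  ; unit-odd    = unit-odd
  ; factorised  = begin
      n * pow 2 (2 ℕ.* b)                      ≡⟨ cong (_* pow 2 (2 ℕ.* b)) factorised ⟩
      pow 2 exponent * unit * pow 2 (2 ℕ.* b)  ≡⟨ swap (pow 2 exponent) unit (pow 2 (2 ℕ.* b)) ⟩
      pow 2 exponent * pow 2 (2 ℕ.* b) * unit  ≡⟨ cong (_* unit) (pow-+ 2 exponent (2 ℕ.* b)) ⟨
      pow 2 (exponent ℕ.+ 2 ℕ.* b) * unit      ∎
  ; obstruction = map₁ (trans (shift exponent b)) obstruction
  }
  where
  open NonSquare₂ N
  open ≡-Reasoning
  swap : ∀ A u B → A * u * B ≡ A * B * u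
  swap = solve-∀
  shift : ∀ s b → (s ℕ.+ 2 ℕ.* b) % 2 ≡ s % 2
  shift s b = trans (cong (λ m → (s ℕ.+ m) % 2) (ℕₚ.*-comm 2 b)) ([m+kn]%n≡m%n s b 2)

2-adic-square-shape : ∀ {s V} e Y → Odd V →
  pow 2 (3 ℕ.+ (2 ℕ.* s ℕ.+ 2 ℕ.* e)) ∣ Y * Y * pow 2 (2 ℕ.* e) - pow 2 s * V →
  s % 2 ≡ 0 × + 8 ∣ V - + 1
2-adic-square-shape {s} {V} e Y odd-V 2^K∣ with 2-power-split (suc s) Y
... | inj₁ 2^[1+s]∣Y = ⊥-elim (odd-part-exact s odd-V
  (subst (pow 2 (suc s) ∣_) (cancel (Y * Y * pow 2 (2 ℕ.* e)) (pow 2 s * V))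
    (∣m∣n⇒∣m-n (∣m⇒∣m*n (pow 2 (2 ℕ.* e)) (∣m⇒∣m*n Y 2^[1+s]∣Y))
                (∣-trans (pow-mono-∣ 2 1+s≤K) 2^K∣))))
  where
  1+s≤K : suc s ℕ.≤ 3 ℕ.+ (2 ℕ.* s ℕ.+ 2 ℕ.* e)
  1+s≤K = ℕₚ.≤-trans (ℕₚ.m≤n+m (suc s) 2)
            (ℕₚ.+-monoʳ-≤ 3 (ℕₚ.≤-trans (ℕₚ.m≤n*m s 2) (ℕₚ.m≤m+n _ _)))
  cancel : ∀ L n → L - (L - n) ≡ n
  cancel = solve-∀
... | inj₂ (i , i<1+s , w , odd-w , refl) = even-exponent , 8∣V-1
  where
  square-of-2-power-times : (pow 2 i * w) * (pow 2 i * w) * pow 2 (2 ℕ.* e)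
                            ≡ pow 2 (2 ℕ.* i ℕ.+ 2 ℕ.* e) * (w * w)
  square-of-2-power-times = begin
    (pow 2 i * w) * (pow 2 i * w) * pow 2 (2 ℕ.* e)
      ≡⟨ regroup (pow 2 i) w (pow 2 (2 ℕ.* e)) ⟩
    pow 2 i * pow 2 i * pow 2 (2 ℕ.* e) * (w * w)
      ≡⟨ cong (λ A → A * pow 2 (2 ℕ.* e) * (w * w)) (pow-double 2 i) ⟨
    pow 2 (2 ℕ.* i) * pow 2 (2 ℕ.* e) * (w * w)
      ≡⟨ cong (_* (w * w)) (pow-+ 2 (2 ℕ.* i) (2 ℕ.* e)) ⟨
    pow 2 (2 ℕ.* i ℕ.+ 2 ℕ.* e) * (w * w) ∎
    where
    open ≡-Reasoning
    regroup : ∀ A w B → (A * w) * (A * w) * B ≡ A * A * B * (w * w)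
    regroup = solve-∀

  agree = odd-parts-agree (odd-* odd-w odd-w) odd-V
    (ℕₚ.+-monoʳ-≤ 3 (ℕₚ.+-monoˡ-≤ (2 ℕ.* e) (ℕₚ.*-monoʳ-≤ 2 (ℕₚ.≤-pred i<1+s))))
    (ℕₚ.+-monoʳ-≤ 3 (ℕₚ.≤-trans (ℕₚ.m≤n*m s 2) (ℕₚ.m≤m+n _ _)))
    (subst (λ L → pow 2 (3 ℕ.+ (2 ℕ.* s ℕ.+ 2 ℕ.* e)) ∣ L - pow 2 s * V)
           square-of-2-power-times 2^K∣)

  even-exponent : s % 2 ≡ 0
  even-exponent = begin
    s % 2                          ≡⟨ cong (_% 2) (proj₁ agree) ⟨
    (2 ℕ.* i ℕ.+ 2 ℕ.* e) % 2      ≡⟨ cong (_% 2) (ℕₚ.*-distribˡ-+ 2 i e) ⟨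
    (2 ℕ.* (i ℕ.+ e)) % 2          ≡⟨ cong (_% 2) (ℕₚ.*-comm 2 (i ℕ.+ e)) ⟩
    ((i ℕ.+ e) ℕ.* 2) % 2          ≡⟨ m*n%n≡0 (i ℕ.+ e) 2 ⟩
    0                              ∎
    where open ≡-Reasoning

  8∣V-1 : + 8 ∣ V - + 1
  8∣V-1 = subst (+ 8 ∣_) (cancel (proj₁ (odd-square odd-w)) V)
    (∣m∣n⇒∣m-n (∣n⇒∣m*n (proj₁ (odd-square odd-w)) ∣-refl)
               (subst (λ m → + 8 ∣ m - V) (proj₂ (odd-square odd-w)) (proj₂ agree)))
    where
    cancel : ∀ M V → M * + 8 - (+ 1 + + 8 * M - V) ≡ V - + 1
    cancel = solve-∀

NonSquare₂⇒not-square-mod : ∀ {n} (N : NonSquare₂ n) e Y →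
  let open NonSquare₂ N in
  ¬ (pow 2 (3 ℕ.+ (2 ℕ.* exponent ℕ.+ 2 ℕ.* e)) ∣ Y * Y * pow 2 (2 ℕ.* e) - n)
NonSquare₂⇒not-square-mod
  record { exponent = s ; unit = V ; unit-odd = odd-V ; factorised = refl ; obstruction = obstruction }
  e Y 2^K∣ =
  [ (λ s-odd → ℕₚ.0≢1+n (trans (sym (proj₁ shape)) s-odd)) , (λ 8∤V-1 → 8∤V-1 (proj₂ shape)) ]′
    obstruction
  where
  shape = 2-adic-square-shape {s} {V} e Y odd-V 2^K∣

NonSquare₂≤ : ℕ → ℤ → Set
NonSquare₂≤ B n = Σ (NonSquare₂ n) λ N → NonSquare₂.exponent N ℕ.≤ B

-- With P = 5 + 8T and e = 2^a, the cases below are: X/e ∈ 2ℤ₂, where the quartic is e⁴ times a unit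
-- ≡ -P(P + 2) ≡ 5 (mod 8); X/e of negative valuation, where it is (2-part of X)⁴ times a unit
-- ≡ -(odd)⁴ ≡ 7 (mod 8); X/e a unit x, where x² - P ≡ 4 and x² - P - 2 ≡ 2 (mod 8) give e⁴ · 8 · odd.
module _ (T : ℤ) where

  private
    P : ℤ
    P = + 5 + + 8 * T

  quartic-even-ratio : ∀ a w →
    NonSquare₂≤ (4 ℕ.* a ℕ.+ 3) (quartic P (P + + 2) (w * pow 2 (suc a)) (pow 2 a))
  quartic-even-ratio a w = record
    { exponent    = 4 ℕ.* a
    ; unit        = + 5 + + 8 * W
    ; unit-odd    = odd-+8* W (+ 2 , refl)
    ; factorised  = begin
        quartic P (P + + 2) (w * pow 2 (suc a)) E
          ≡⟨ cong₂ (quartic P (P + + 2)) (trans (cong (w *_) (pow-suc 2 a)) (regroup w E))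
                                          (sym (ℤₚ.*-identityʳ E)) ⟩
        quartic P (P + + 2) (E * (+ 2 * w)) (E * + 1)
          ≡⟨ quartic-homogeneous P (P + + 2) E (+ 2 * w) (+ 1) ⟩
        (E * E) * (E * E) * quartic P (P + + 2) (+ 2 * w) (+ 1)
          ≡⟨ cong₂ _*_ (sym (pow-quadruple 2 a)) (residue-5 T w) ⟩
        pow 2 (4 ℕ.* a) * (+ 5 + + 8 * W) ∎
    ; obstruction = inj₂ (≢1-mod-8 5 W (toWitnessFalse {a? = + 8 ∣? (+ 5 - + 1)} _))
    } , ℕₚ.m≤m+n (4 ℕ.* a) 3
    where
    open ≡-Reasoning
    E = pow 2 a
    W = - (+ 2 * w * w * w * w) + (+ 6 + + 8 * T) * w * w - + 5 - + 12 * T - + 8 * T * T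
    regroup : ∀ w E → w * (E * + 2) ≡ E * (+ 2 * w)
    regroup = solve-∀
    residue-5 : ∀ T w →
      - ((+ 2 * w * (+ 2 * w) - (+ 5 + + 8 * T) * (+ 1 * + 1))
         * (+ 2 * w * (+ 2 * w) - (+ 5 + + 8 * T + + 2) * (+ 1 * + 1)))
      ≡ + 5 + + 8 * (- (+ 2 * w * w * w * w) + (+ 6 + + 8 * T) * w * w - + 5 - + 12 * T - + 8 * T * T)
    residue-5 = solve-∀

  quartic-fractional-ratio : ∀ j i x → Odd x →
    NonSquare₂≤ (4 ℕ.* (suc j ℕ.+ i) ℕ.+ 3) (quartic P (P + + 2) (pow 2 j * x) (pow 2 (suc j ℕ.+ i)))
  quartic-fractional-ratio j i x odd-x = record
    { exponent    = 4 ℕ.* j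
    ; unit        = + 7 + + 8 * W
    ; unit-odd    = odd-+8* W (+ 3 , refl)
    ; factorised  = begin
        quartic P (P + + 2) (F * x) (pow 2 (suc j ℕ.+ i))
          ≡⟨ cong (quartic P (P + + 2) (F * x)) E≡F*2D ⟩
        quartic P (P + + 2) (F * x) (F * (+ 2 * D))
          ≡⟨ quartic-homogeneous P (P + + 2) F x (+ 2 * D) ⟩
        (F * F) * (F * F) * quartic P (P + + 2) x (+ 2 * D)
          ≡⟨ cong (λ m → (F * F) * (F * F)
                         * - ((m - P * (+ 2 * D * (+ 2 * D))) * (m - (P + + 2) * (+ 2 * D * (+ 2 * D)))))
                  (proj₂ (odd-square odd-x)) ⟩
        (F * F) * (F * F) * - ((m - P * (+ 2 * D * (+ 2 * D))) * (m - (P + + 2) * (+ 2 * D * (+ 2 * D))))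
          ≡⟨ cong₂ _*_ (sym (pow-quadruple 2 j)) (residue-7 T M D) ⟩
        pow 2 (4 ℕ.* j) * (+ 7 + + 8 * W) ∎
    ; obstruction = inj₂ (≢1-mod-8 7 W (toWitnessFalse {a? = + 8 ∣? (+ 7 - + 1)} _))
    } , ℕₚ.≤-trans (ℕₚ.*-monoʳ-≤ 4 (ℕₚ.≤-trans (ℕₚ.n≤1+n j) (ℕₚ.m≤m+n (suc j) i)))
                   (ℕₚ.m≤m+n _ 3)
    where
    open ≡-Reasoning
    F = pow 2 j
    D = pow 2 i
    M = proj₁ (odd-square odd-x)
    m = + 1 + + 8 * M
    W = - + 1 - + 2 * M - + 8 * M * M + (+ 6 + + 8 * T) * D * D * m - + 2 * P * (P + + 2) * D * D * D * D
    E≡F*2D : pow 2 (suc j ℕ.+ i) ≡ F * (+ 2 * D)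
    E≡F*2D = trans (pow-+ 2 (suc j) i) (trans (cong (_* D) (pow-suc 2 j)) (ℤₚ.*-assoc F (+ 2) D))
    residue-7 : ∀ T M D →
      - ((+ 1 + + 8 * M - (+ 5 + + 8 * T) * (+ 2 * D * (+ 2 * D)))
         * (+ 1 + + 8 * M - (+ 5 + + 8 * T + + 2) * (+ 2 * D * (+ 2 * D))))
      ≡ + 7 + + 8 * (- + 1 - + 2 * M - + 8 * M * M + (+ 6 + + 8 * T) * D * D * (+ 1 + + 8 * M)
                      - + 2 * (+ 5 + + 8 * T) * (+ 5 + + 8 * T + + 2) * D * D * D * D)
    residue-7 = solve-∀

  quartic-unit-ratio : ∀ a x → Odd x →
    NonSquare₂≤ (4 ℕ.* a ℕ.+ 3) (quartic P (P + + 2) (pow 2 a * x) (pow 2 a))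
  quartic-unit-ratio a x odd-x = record
    { exponent    = 4 ℕ.* a ℕ.+ 3
    ; unit        = V
    ; unit-odd    = odd-neg (odd-* (α , refl) (β , refl))
    ; factorised  = begin
        quartic P (P + + 2) (E * x) E
          ≡⟨ cong (quartic P (P + + 2) (E * x)) (sym (ℤₚ.*-identityʳ E)) ⟩
        quartic P (P + + 2) (E * x) (E * + 1)
          ≡⟨ quartic-homogeneous P (P + + 2) E x (+ 1) ⟩
        (E * E) * (E * E) * quartic P (P + + 2) x (+ 1)
          ≡⟨ cong (λ m → (E * E) * (E * E) * - ((m - P * (+ 1 * + 1)) * (m - (P + + 2) * (+ 1 * + 1))))
                  (proj₂ (odd-square odd-x)) ⟩
        (E * E) * (E * E) * - ((m - P * (+ 1 * + 1)) * (m - (P + + 2) * (+ 1 * + 1)))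
          ≡⟨ cong₂ _*_ (sym (pow-quadruple 2 a)) (valuation-3 T M) ⟩
        pow 2 (4 ℕ.* a) * (+ 8 * V)
          ≡⟨ ℤₚ.*-assoc (pow 2 (4 ℕ.* a)) (+ 8) V ⟨
        pow 2 (4 ℕ.* a) * + 8 * V
          ≡⟨ cong (_* V) (pow-+ 2 (4 ℕ.* a) 3) ⟨
        pow 2 (4 ℕ.* a ℕ.+ 3) * V ∎
    ; obstruction = inj₁ (trans (cong (_% 2) (odd-exponent a)) ([m+kn]%n≡m%n 1 (2 ℕ.* a ℕ.+ 1) 2))
    } , ℕₚ.≤-refl
    where
    open ≡-Reasoning
    E = pow 2 a
    M = proj₁ (odd-square odd-x)
    m = + 1 + + 8 * M
    α = M - T - + 1
    β = + 2 * (M - T) - + 2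
    V = - ((+ 1 + + 2 * α) * (+ 1 + + 2 * β))
    valuation-3 : ∀ T M →
      - ((+ 1 + + 8 * M - (+ 5 + + 8 * T) * (+ 1 * + 1))
         * (+ 1 + + 8 * M - (+ 5 + + 8 * T + + 2) * (+ 1 * + 1)))
      ≡ + 8 * - ((+ 1 + + 2 * (M - T - + 1)) * (+ 1 + + 2 * (+ 2 * (M - T) - + 2)))
    valuation-3 = solve-∀
    odd-exponent : ∀ a → 4 ℕ.* a ℕ.+ 3 ≡ 1 ℕ.+ (2 ℕ.* a ℕ.+ 1) ℕ.* 2
    odd-exponent = ℕ-Solver.solve-∀

  quartic-NonSquare₂ : ∀ a X → NonSquare₂≤ (4 ℕ.* a ℕ.+ 3) (quartic P (P + + 2) X (pow 2 a))
  quartic-NonSquare₂ a X with 2-power-split (suc a) X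
  ... | inj₁ (divides w refl) = quartic-even-ratio a w
  ... | inj₂ (j , j<1+a , x , odd-x , refl) with ℕₚ.m≤n⇒m<n∨m≡n (ℕₚ.≤-pred j<1+a)
  ...   | inj₂ refl = quartic-unit-ratio j x odd-x
  ...   | inj₁ j<a with ℕₚ.m≤n⇒∃[o]m+o≡n j<a
  ...     | i , refl = quartic-fractional-ratio j i x odd-x

no-point-over-ℚ₂ : ∀ {p} T → + p ≡ + 5 + + 8 * T → ¬ C'HasPoint p (p ℕ.+ 2) 2
no-point-over-ℚ₂ {p} T p≡5+8T (X /ℓ^ a , Y /ℓ^ b , on-curve) =
  NonSquare₂⇒not-square-mod (NonSquare₂-*-pow-even N b) (2 ℕ.* a) y
    (∣-trans (pow-mono-∣ 2 precision) 2^K∣)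
  where
  P = + 5 + + 8 * T
  -- The precision depends on a and b only, since the exponent of the quartic is at most 4a + 3.
  K = 3 ℕ.+ (2 ℕ.* (4 ℕ.* a ℕ.+ 3 ℕ.+ 2 ℕ.* b) ℕ.+ 2 ℕ.* (2 ℕ.* a))
  x = seq X K
  y = seq Y K
  N = proj₁ (quartic-NonSquare₂ T a x)

  precision : 3 ℕ.+ (2 ℕ.* (NonSquare₂.exponent N ℕ.+ 2 ℕ.* b) ℕ.+ 2 ℕ.* (2 ℕ.* a)) ℕ.≤ K
  precision = ℕₚ.+-monoʳ-≤ 3 (ℕₚ.+-monoˡ-≤ (2 ℕ.* (2 ℕ.* a))
                (ℕₚ.*-monoʳ-≤ 2 (ℕₚ.+-monoˡ-≤ (2 ℕ.* b) (proj₂ (quartic-NonSquare₂ T a x)))))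

  2^K∣ : pow 2 K ∣ y * y * pow 2 (2 ℕ.* (2 ℕ.* a)) - quartic P (P + + 2) x (pow 2 a) * pow 2 (2 ℕ.* b)
  2^K∣ = subst₂ (λ L R → pow 2 K ∣ y * y * L - R * pow 2 (2 ℕ.* b))
           (cong (pow 2) (ℕₚ.*-assoc 2 2 a))
           (trans (curve-rhs≡quartic p (p ℕ.+ 2) 2 a x)
                  (cong₂ (λ A B → quartic A B x (pow 2 a))
                         p≡5+8T (trans (twin-cast p) (cong (_+ + 2) p≡5+8T))))
           (∣ᵤ⇒∣ (on-curve K))

point-over-ℚ₂-p≡3 : ∀ {p} T → + p ≡ + 3 + + 8 * T → C'HasPoint p (p ℕ.+ 2) 2
point-over-ℚ₂-p≡3 {p} T p≡3+8T = point-with-x≡ {p} {p ℕ.+ 2} (+ 0)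
  (Root-map (λ z → x≡0 z (+ p) (+ (p ℕ.+ 2)))
    (hensel-sqrt₂ (- (+ p * + (p ℕ.+ 2))) (- + 2 - + 8 * T - + 8 * T * T)
      (trans (cong₂ (λ A B → - (A * B)) p≡3+8T (trans (twin-cast p) (cong (_+ + 2) p≡3+8T)))
             (residue-1 T))))
  where
  x≡0 : ∀ z P Q → z * z - - (P * Q) ≡ z * z + (+ 0 * + 0 - P) * (+ 0 * + 0 - Q)
  x≡0 = solve-∀
  residue-1 : ∀ T → - ((+ 3 + + 8 * T) * (+ 3 + + 8 * T + + 2))
                    ≡ + 1 + + 8 * (- + 2 - + 8 * T - + 8 * T * T)
  residue-1 = solve-∀

twin-prime-odd : ∀ {p} → Prime p → Prime (p ℕ.+ 2) → ¬ 2 ℕᵈ.∣ p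
twin-prime-odd p-prime q-prime 2∣p with prime⇒irreducible p-prime 2∣p
... | inj₁ ()
... | inj₂ refl with prime⇒irreducible q-prime {2} (ℕᵈ.divides 2 refl)
...   | inj₁ ()
...   | inj₂ ()

¬2∣⇒odd : ∀ {n} → ¬ 2 ℕᵈ.∣ n → Σ ℕ λ r → n ≡ suc (2 ℕ.* r)
¬2∣⇒odd {n} 2∤n with n % 2 | m%n<n n 2 | m≡m%n+[m/n]*n n 2
... | 0           | _                 | n≡ = ⊥-elim (2∤n (ℕᵈ.divides (n / 2) n≡))
... | 1           | _                 | n≡ = n / 2 , trans n≡ (cong suc (ℕₚ.*-comm (n / 2) 2))
... | suc (suc _) | ℕ.s≤s (ℕ.s≤s ()) | _

point-over-ℚ₂⇔ : ∀ p → ¬ 2 ℕᵈ.∣ p →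
  C'HasPoint p (p ℕ.+ 2) 2 ⇔ (p % 8 ≡ 1 ⊎ p % 8 ≡ 3 ⊎ p % 8 ≡ 7)
point-over-ℚ₂⇔ p 2∤p = by-residue (p % 8) (p / 8) (m≡m%n+[m/n]*n p 8) (m%n<n p 8)
  where
  2∤residue : ∀ {m} t → p ≡ m ℕ.+ t ℕ.* 8 → ¬ 2 ℕᵈ.∣ m
  2∤residue t p≡m+8t 2∣m = 2∤p (subst (2 ℕᵈ.∣_) (sym p≡m+8t)
    (ℕᵈ.∣m∣n⇒∣m+n 2∣m (ℕᵈ.∣n⇒∣m*n t (ℕᵈ.divides 4 refl))))

  cast : ∀ {m} t → p ≡ m ℕ.+ t ℕ.* 8 → + p ≡ + m + + 8 * + t
  cast {m} t refl =
    trans (ℤₚ.pos-+ m (t ℕ.* 8)) (cong (_+_ (+ m)) (trans (ℤₚ.pos-* t 8) (ℤₚ.*-comm (+ t) (+ 8))))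

  by-residue : ∀ m t → p ≡ m ℕ.+ t ℕ.* 8 → m ℕ.< 8 →
    C'HasPoint p (p ℕ.+ 2) 2 ⇔ (m ≡ 1 ⊎ m ≡ 3 ⊎ m ≡ 7)
  by-residue 0 t p≡ _ = ⊥-elim (2∤residue t p≡ (ℕᵈ.divides 0 refl))
  by-residue 1 t p≡ _ = mk⇔ (λ _ → inj₁ refl)
    (λ _ → point-with-x²≡p {p} {p ℕ.+ 2} (hensel-sqrt₂ (+ p) (+ t) (cast t p≡)))
  by-residue 2 t p≡ _ = ⊥-elim (2∤residue t p≡ (ℕᵈ.divides 1 refl))
  by-residue 3 t p≡ _ = mk⇔ (λ _ → inj₂ (inj₁ refl))
    (λ _ → point-over-ℚ₂-p≡3 (+ t) (cast t p≡))
  by-residue 4 t p≡ _ = ⊥-elim (2∤residue t p≡ (ℕᵈ.divides 2 refl))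
  by-residue 5 t p≡ _ = mk⇔ (⊥-elim ∘ no-point-over-ℚ₂ (+ t) (cast t p≡))
                            λ { (inj₁ ()) ; (inj₂ (inj₁ ())) ; (inj₂ (inj₂ ())) }
  by-residue 6 t p≡ _ = ⊥-elim (2∤residue t p≡ (ℕᵈ.divides 3 refl))
  by-residue 7 t p≡ _ = mk⇔ (λ _ → inj₂ (inj₂ refl))
    (λ _ → point-with-x²≡q {p} (hensel-sqrt₂ (+ (p ℕ.+ 2)) (+ t + + 1)
             (trans (twin-cast p) (trans (cong (_+ + 2) (cast t p≡)) (shift (+ t))))))
    where
    shift : ∀ t → + 7 + + 8 * t + + 2 ≡ + 1 + + 8 * (t + + 1)
    shift = solve-∀
  by-residue (suc (suc (suc (suc (suc (suc (suc (suc k)))))))) _ _ m<8 = ⊥-elim (ℕₚ.m+n≮m 8 k m<8)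

proposition3p6 : (p q : ℕ) → Prime p → Prime q → q ≡ p ℕ.+ 2 →
    (C'HasPoint p q p × C'HasPoint p q q)
    × (C'HasPoint p q 2 ⇔ (p % 8 ≡ 1 ⊎ p % 8 ≡ 3 ⊎ p % 8 ≡ 7))
proposition3p6 p q p-prime q-prime refl =
  (point-over-ℚ_p r p≡2r+1 , point-over-ℚ_q r p≡2r+1 q-prime) , point-over-ℚ₂⇔ p 2∤p
  where
  2∤p = twin-prime-odd p-prime q-prime
  r = proj₁ (¬2∣⇒odd 2∤p)
  p≡2r+1 = proj₂ (¬2∣⇒odd 2∤p)
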